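{- For each $f(x_1,\ldots,x_n/a_1,\ldots,a_m)$ in ${\sf PCSF}$ there exists a polynomial $p_f$ such that for all hereditarily finite sets $X_1,\ldots,X_n$ and $A_1,\ldots,A_m$, \[cT(f(X_1,\ldots,X_n/A_1,\ldots,A_m))\le p_f(cT(X_1),\ldots,cT(X_n))+cT(A_1\cup\cdots\cup A_m),\] where $cT(X)=\mathrm{card}(\mathrm{TC}(X))$ is the cardinality of the transitive closure of $X$.
   Context: Functions are set-theoretic functions on the universe of sets, written $f(x_1,\ldots,x_n/a_1,\ldots,a_m)$: arguments before the slash are called normal, after it safe (either list may be empty, written $-$). The class ${\sf PCSF}^-$ consists of functions with no normal arguments; it contains the projections $\pi^{ -,m}_j(-/a_1,\ldots,a_m)=a_j$, $\mathrm{pair}(-/a,b)=\{a,b\}$, $\mathrm{null}(-/-)=\emptyset$, $\mathrm{union}(-/a)=\bigcup a$, and $\mathrm{Cond}_\in(-/a,b,c,d)$, which equals $a$ if $c\in d$ and $b$ otherwise; and it is closed under composition $f(-/\vec a)=h(-/t_1(-/\vec a),\ldots,t_k(-/\vec a))$ and under safe separation: if $h(-/\vec a,b)\in{\sf PCSF}^-$ then $f(-/\vec a,c)=\{b\in c: h(-/\vec a,b)\neq\emptyset\}\in{\sf PCSF}^-$. The class ${\sf PCSF}$ is the smallest class containing ${\sf PCSF}^-$ and all projections $\pi^{n,m}_j(x_1,\ldots,x_n/x_{n+1},\ldots,x_{n+m})=x_j$ ($1\le j\le n+m$), and closed under safe composition $f(\vec x/\vec a)=h(r_1(\vec x/-),\ldots,r_k(\vec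 x/-)/t_1(\vec x/\vec a),\ldots,t_l(\vec x/\vec a))$ (with $h,r_i,t_j\in{\sf PCSF}$, the $r_i$ having no safe arguments) and predicative set recursion $f(x,\vec y/\vec a)=h(x,\vec y/\vec a,\{f(z,\vec y/\vec a): z\in x\})$ (with $h\in{\sf PCSF}$). $\mathrm{TC}(X)$ is the transitive closure of $X$; the empty union ($m=0$) is $\emptyset$. -}

module Defs where

-- Hereditarily finite sets are represented by their Ackermann codes:
-- every natural number y codes the HF set whose elements are the codes x
-- such that bit x of the binary expansion of y is 1.  This is a bijection
-- between ℕ and the hereditarily finite sets, with membership as below,
-- so extensional equality of HF sets is plain ≡ on codes.

open import Data.Nat using (ℕ; zero; suc; _+_; _*_; _≤_; _<_; _%_; ⌊_/2⌋; _^_; _≡ᵇ_)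
open import Data.Nat.Induction using (<-rec)
open import Data.Bool using (Bool; true; false; if_then_else_; not)
open import Data.Fin using (Fin; toℕ)
open import Data.Fin.Properties using (toℕ<n)
open import Data.List using (List; []; _∷_; map; length; foldr; concatMap; filterᵇ)
open import Data.Fin.Base using () renaming (_↑ˡ_ to _↑ˡ_)
open import Data.Vec using (Vec; []; _∷_; lookup; _++_; _∷ʳ_; init; last; toList)
import Data.Vec as V
open import Data.Product using (Σ; _,_; proj₁; proj₂)
import Data.List as L

bit : ℕ → ℕ → Bool
bit zero    y = y % 2 ≡ᵇ 1
bit (suc x) y = bit x ⌊ y /2⌋

_∈ₕ_ : ℕ → ℕ → Set
x ∈ₕ y = bit x y ≡ true
  where open import Relation.Binary.PropositionalEquality using (_≡_)

-- the elements of y, each together with the (true) fact that it is < y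
-- (if x ∈ y then y ≥ 2^x > x, so scanning 0 … y-1 finds all elements)
elemsLt : (y : ℕ) → List (Σ ℕ (λ z → z < y))
elemsLt y = map (λ i → toℕ i , toℕ<n i) (filterᵇ (λ i → bit (toℕ i) y) (L.allFin y))

elems : ℕ → List ℕ
elems y = map proj₁ (elemsLt y)

insert : ℕ → ℕ → ℕ
insert x s = if bit x s then s else s + 2 ^ x

fromList : List ℕ → ℕ
fromList = foldr insert 0

card : ℕ → ℕ
card y = length (elems y)

_∪ₕ_ : ℕ → ℕ → ℕ
a ∪ₕ b = fromList (elems a L.++ elems b)

⋃ₕ : ℕ → ℕ
⋃ₕ a = fromList (concatMap elems (elems a))

bigUnion : ∀ {m} → Vec ℕ m → ℕ
bigUnion as = fromList (concatMap elems (toList as))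

TC : ℕ → ℕ
TC = <-rec (λ _ → ℕ) step
  where
  step : (x : ℕ) → (∀ {z} → z < x → ℕ) → ℕ
  step x rec = fromList (concatMap (λ p → proj₁ p ∷ elems (rec (proj₂ p))) (elemsLt x))

cT : ℕ → ℕ
cT x = card (TC x)

pairₕ : ℕ → ℕ → ℕ
pairₕ a b = fromList (a ∷ b ∷ [])

nullₕ : ℕ
nullₕ = 0

condₕ : ℕ → ℕ → ℕ → ℕ → ℕ
condₕ a b c d = if bit c d then a else b

isEmpty : ℕ → Bool
isEmpty y = y ≡ᵇ 0

-- Syntax of PCSF⁻ : m = number of safe arguments

data PCSF⁻ : ℕ → Set where
  proj⁻  : ∀ {m} → Fin m → PCSF⁻ m
  pair⁻  : PCSF⁻ 2
  null⁻  : PCSF⁻ 0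
  union⁻ : PCSF⁻ 1
  cond⁻  : PCSF⁻ 4
  comp⁻  : ∀ {m k} → PCSF⁻ k → (Fin k → PCSF⁻ m) → PCSF⁻ m
  sep⁻   : ∀ {m} → PCSF⁻ (suc m) → PCSF⁻ (suc m)

eval⁻ : ∀ {m} → PCSF⁻ m → Vec ℕ m → ℕ
eval⁻ (proj⁻ j)   as = lookup as j
eval⁻ pair⁻       (a ∷ b ∷ []) = pairₕ a b
eval⁻ null⁻       [] = nullₕ
eval⁻ union⁻      (a ∷ []) = ⋃ₕ a
eval⁻ cond⁻       (a ∷ b ∷ c ∷ d ∷ []) = condₕ a b c d
eval⁻ (comp⁻ h t) as = eval⁻ h (V.tabulate (λ i → eval⁻ (t i) as))
eval⁻ (sep⁻ h)    as =
  fromList (filterᵇ (λ b → not (isEmpty (eval⁻ h (init as ∷ʳ b)))) (elems (last as)))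

-- Syntax of PCSF : n normal arguments, m safe arguments

data PCSF : ℕ → ℕ → Set where
  base : ∀ {m} → PCSF⁻ m → PCSF 0 m
  proj : ∀ {n m} → Fin (n + m) → PCSF n m
  scomp : ∀ {n m k l} → PCSF k l → (Fin k → PCSF n 0) → (Fin l → PCSF n m) → PCSF n m
  srec : ∀ {n m} → PCSF (suc n) (suc m) → PCSF (suc n) m

-- recursion along ∈ (every element of x is < x as a code)
∈-rec : (ℕ → ℕ → ℕ) → ℕ → ℕ
∈-rec g = <-rec (λ _ → ℕ) step
  where
  step : (x : ℕ) → (∀ {z} → z < x → ℕ) → ℕ
  step x rec = g x (fromList (map (λ p → rec (proj₂ p)) (elemsLt x)))

eval : ∀ {n m} → PCSF n m → Vec ℕ n → Vec ℕ m → ℕ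
eval (base h)      []       as = eval⁻ h as
eval (proj j)      xs       as = lookup (xs ++ as) j
eval (scomp h r t) xs       as =
  eval h (V.tabulate (λ i → eval (r i) xs [])) (V.tabulate (λ i → eval (t i) xs as))
eval (srec h)      (x ∷ ys) as = ∈-rec (λ z S → eval h (z ∷ ys) (as ∷ʳ S)) x

data Poly (n : ℕ) : Set where
  var  : Fin n → Poly n
  con  : ℕ → Poly n
  _:+_ : Poly n → Poly n → Poly n
  _:*_ : Poly n → Poly n → Poly n

evalPoly : ∀ {n} → Poly n → Vec ℕ n → ℕ
evalPoly (var i)  v = lookup v i
evalPoly (con c)  v = c
evalPoly (p :+ q) v = evalPoly p v + evalPoly q v
evalPoly (p :* q) v = evalPoly p v * evalPoly q v

module Submission where

-- The argument proves a stronger, compositional invariant.  For a set y and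
-- safe arguments a⃗, a "cover" of y over a⃗ is a finite list S with
--     TC(y) ⊆ TC(A₁ ∪ ⋯ ∪ Aₘ) ∪ S,
-- so that cT(y) ≤ |S| + cT(A₁ ∪ ⋯ ∪ Aₘ).  We show, by induction on the
-- syntax of f, that f(x⃗/a⃗) has a cover whose length is bounded by a
-- polynomial p_f(cT(x⃗)) (a constant for f ∈ PCSF⁻).  The safe primitives
-- only rearrange elements of TC(a⃗); pair adds two elements; composition adds
-- up the covers of the inner functions; and for a predicative recursion
-- F(x) = h(x,y⃗/a⃗,{F(z) : z ∈ x}) the invariant is proved by ∈-induction,
-- the extra elements being F(u) and the cover of h at u, for u ∈ {x} ∪ TC(x).

open import Defs
open import Data.Nat using (ℕ; _+_; _≤_)
open import Data.Vec using (Vec; map)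
open import Data.Product using (Σ)

open import Data.Nat using (zero; suc; _*_; _<_; _%_; ⌊_/2⌋; ⌈_/2⌉; _^_; _≡ᵇ_; z≤n; s≤s; _≟_)
open import Data.Nat.Properties
open import Data.Nat.Induction using (<-rec; <-wellFounded)
open import Data.Nat.ListAction using (sum)
open import Data.Bool using (Bool; true; false; T; T?)
open import Data.Bool.Properties using (T-≡)
open import Data.Empty using (⊥-elim)
open import Data.Sum using (_⊎_; inj₁; inj₂; [_,_]′; map₁; map₂)
open import Data.Product using (_×_; _,_; proj₁; proj₂; ∃)
import Data.Product as Prod
open import Data.Fin as Fin using (Fin; toℕ; fromℕ<; splitAt)
open import Data.Fin.Properties using (toℕ<n; toℕ-fromℕ<; toℕ-injective)
import Data.List as L
open L using (List; []; _∷_; _++_; length; concatMap)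
open import Data.List.Properties using (length-++; map-∘; map-cong; concatMap-map; concatMap-cong)
open import Data.List.Membership.Propositional using (_∈_; find; lose)
open import Data.List.Membership.Propositional.Properties
  using (∈-map⁺; ∈-map⁻; ∈-filter⁺; ∈-filter⁻; ∈-allFin; ∈-++⁻; ∈-++⁺ˡ; ∈-++⁺ʳ; ∈-concatMap⁺; ∈-concatMap⁻; ∈-∃++)
open import Data.List.Relation.Unary.Any using (here; there)
import Data.List.Relation.Unary.All as All
open import Data.List.Relation.Unary.AllPairs using (_∷_)
open import Data.List.Relation.Unary.Unique.Propositional using (Unique)
import Data.List.Relation.Unary.Unique.Propositional.Properties as Unique
open import Data.Vec using (_∷_; []; toList; lookup; tabulate; last; _∷ʳ_) renaming (_++_ to _++ᵥ_)
open import Data.Vec.Properties using (lookup-map; lookup∘tabulate; lookup-splitAt)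
open import Data.Vec.Membership.Propositional using () renaming (_∈_ to _∈ᵥ_)
open import Data.Vec.Membership.Propositional.Properties using (∈-toList⁻; ∈-toList⁺; ∈-lookup)
open import Data.Vec.Relation.Unary.Any using (here; there)
open import Data.Vec.Relation.Unary.Any.Properties using (tabulate⁻)
open import Function using (_∘_; Equivalence)
open import Induction.WellFounded using (module FixPoint)
open import Relation.Nullary using (¬_; yes; no)
open import Relation.Binary.PropositionalEquality
  using (_≡_; _≢_; refl; sym; trans; cong; cong₂; subst)

⌊+double/2⌋ : ∀ s k → ⌊ s + (k + k) /2⌋ ≡ ⌊ s /2⌋ + k
⌊+double/2⌋ s zero    rewrite +-identityʳ s = sym (+-identityʳ _)
⌊+double/2⌋ s (suc k) rewrite +-suc k k | +-suc s (suc (k + k)) | +-suc s (k + k) =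
  trans (cong suc (⌊+double/2⌋ s k)) (sym (+-suc _ k))

+double%2 : ∀ s k → (s + (k + k)) % 2 ≡ s % 2
+double%2 s zero    rewrite +-identityʳ s = refl
+double%2 s (suc k) rewrite +-suc k k | +-suc s (suc (k + k)) | +-suc s (k + k) = +double%2 s k

even+1-odd : ∀ s → (s % 2 ≡ᵇ 1) ≡ false → ((s + 1) % 2 ≡ᵇ 1) ≡ true
even+1-odd zero          _  = refl
even+1-odd (suc zero)    ()
even+1-odd (suc (suc s)) ev = even+1-odd s ev

⌊even+1/2⌋ : ∀ s → (s % 2 ≡ᵇ 1) ≡ false → ⌊ s + 1 /2⌋ ≡ ⌊ s /2⌋
⌊even+1/2⌋ zero          _  = refl
⌊even+1/2⌋ (suc zero)    ()
⌊even+1/2⌋ (suc (suc s)) ev = cong suc (⌊even+1/2⌋ s ev)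

2^suc : ∀ x → 2 ^ suc x ≡ 2 ^ x + 2 ^ x
2^suc x = cong (2 ^ x +_) (+-identityʳ (2 ^ x))

bit-+2^-self : ∀ x s → bit x s ≡ false → bit x (s + 2 ^ x) ≡ true
bit-+2^-self zero    s b = even+1-odd s b
bit-+2^-self (suc x) s b rewrite 2^suc x | ⌊+double/2⌋ s (2 ^ x) = bit-+2^-self x ⌊ s /2⌋ b

bit-+2^-other : ∀ x s z → bit x s ≡ false → z ≢ x → bit z (s + 2 ^ x) ≡ bit z s
bit-+2^-other zero    s zero    b z≢x = ⊥-elim (z≢x refl)
bit-+2^-other zero    s (suc z) b z≢x = cong (bit z) (⌊even+1/2⌋ s b)
bit-+2^-other (suc x) s zero    b z≢x rewrite 2^suc x = cong (_≡ᵇ 1) (+double%2 s (2 ^ x))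
bit-+2^-other (suc x) s (suc z) b z≢x rewrite 2^suc x | ⌊+double/2⌋ s (2 ^ x) =
  bit-+2^-other x ⌊ s /2⌋ z b (z≢x ∘ cong suc)

bit⇒2^≤ : ∀ z y → bit z y ≡ true → 2 ^ z ≤ y
bit⇒2^≤ zero    zero    ()
bit⇒2^≤ zero    (suc y) _ = s≤s z≤n
bit⇒2^≤ (suc z) y       b = begin
  2 ^ suc z         ≡⟨ 2^suc z ⟩
  2 ^ z + 2 ^ z     ≤⟨ +-mono-≤ IH IH ⟩
  ⌊ y /2⌋ + ⌊ y /2⌋ ≤⟨ +-monoʳ-≤ ⌊ y /2⌋ (⌊n/2⌋≤⌈n/2⌉ y) ⟩
  ⌊ y /2⌋ + ⌈ y /2⌉ ≡⟨ ⌊n/2⌋+⌈n/2⌉≡n y ⟩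
  y                 ∎
  where
  open ≤-Reasoning
  IH : 2 ^ z ≤ ⌊ y /2⌋
  IH = bit⇒2^≤ z ⌊ y /2⌋ b

n<2^n : ∀ n → n < 2 ^ n
n<2^n zero    = s≤s z≤n
n<2^n (suc n) rewrite 2^suc n = +-mono-≤ (m^n>0 2 n) (n<2^n n)

-- Membership of codes.  It is wrapped in a record so that both codes can be
-- inferred from a membership proof (z ∈ₕ y unfolds to a bit test on y).
record _∈ˢ_ (z y : ℕ) : Set where
  constructor mem
  field bit-set : z ∈ₕ y
open _∈ˢ_

_⊆ˢ_ : ℕ → ℕ → Set
x ⊆ˢ y = ∀ {z} → z ∈ˢ x → z ∈ˢ y

∈⇒< : ∀ {z y} → z ∈ˢ y → z < y
∈⇒< {z} {y} (mem b) = <-≤-trans (n<2^n z) (bit⇒2^≤ z y b)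

∉∅ : ∀ {z} → ¬ z ∈ˢ 0
∉∅ = n≮0 ∘ ∈⇒<

∈-induction : (P : ℕ → Set) → (∀ x → (∀ {w} → w ∈ˢ x → P w) → P x) → ∀ x → P x
∈-induction P step = <-rec P (λ x IH → step x (IH ∘ ∈⇒<))

-- insert x s = s ∪ {x}: if bit x of s is 0, adding 2ˣ sets it and no other bit.
∈-insert⁻ : ∀ x s {z} → z ∈ˢ insert x s → z ≡ x ⊎ z ∈ˢ s
∈-insert⁻ x s {z} (mem z∈) with bit x s in bit-x
... | true  = inj₂ (mem z∈)
... | false with z ≟ x
...   | yes z≡x = inj₁ z≡x
...   | no  z≢x = inj₂ (mem (trans (sym (bit-+2^-other x s z bit-x z≢x)) z∈))

∈-insert⁺ : ∀ x s {z} → z ≡ x ⊎ z ∈ˢ s → z ∈ˢ insert x s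
∈-insert⁺ x s {z} z∈ with bit x s in bit-x
∈-insert⁺ x s (inj₁ refl)         | true  = mem bit-x
∈-insert⁺ x s (inj₂ (mem z∈))     | true  = mem z∈
∈-insert⁺ x s (inj₁ refl)         | false = mem (bit-+2^-self x s bit-x)
∈-insert⁺ x s {z} (inj₂ (mem z∈)) | false with z ≟ x
... | yes refl = mem (bit-+2^-self x s bit-x)
... | no  z≢x  = mem (trans (bit-+2^-other x s z bit-x z≢x) z∈)

∈-fromList⁻ : ∀ l {z} → z ∈ˢ fromList l → z ∈ l
∈-fromList⁻ []      z∈ = ⊥-elim (∉∅ z∈)
∈-fromList⁻ (x ∷ l) z∈ = [ here , there ∘ ∈-fromList⁻ l ]′ (∈-insert⁻ x (fromList l) z∈)

∈-fromList⁺ : ∀ l {z} → z ∈ l → z ∈ˢ fromList l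
∈-fromList⁺ (x ∷ l) (here z≡x)  = ∈-insert⁺ x (fromList l) (inj₁ z≡x)
∈-fromList⁺ (x ∷ l) (there z∈l) = ∈-insert⁺ x (fromList l) (inj₂ (∈-fromList⁺ l z∈l))

∈-elems⁻ : ∀ {z y} → z ∈ elems y → z ∈ˢ y
∈-elems⁻ {y = y} z∈ with _ , p∈ , refl ← ∈-map⁻ proj₁ z∈
                   with _ , i∈ , refl ← ∈-map⁻ _ p∈ =
  mem (Equivalence.to T-≡ (proj₂ (∈-filter⁻ (λ i → T? (bit (toℕ i) y)) {xs = L.allFin y} i∈)))

∈-elems⁺ : ∀ {z y} → z ∈ˢ y → z ∈ elems y
∈-elems⁺ {z} {y} z∈ = subst (_∈ elems y) (toℕ-fromℕ< z<y)
  (∈-map⁺ proj₁ (∈-map⁺ (λ i → toℕ i , toℕ<n i)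
    (∈-filter⁺ (λ i → T? (bit (toℕ i) y)) {xs = L.allFin y} (∈-allFin i) bit-i)))
  where
  z<y : z < y
  z<y = ∈⇒< z∈
  i : Fin y
  i = fromℕ< z<y
  bit-i : T (bit (toℕ i) y)
  bit-i = Equivalence.from T-≡ (subst (λ w → bit w y ≡ true) (sym (toℕ-fromℕ< z<y)) (bit-set z∈))

elems-unique : ∀ y → Unique (elems y)
elems-unique y = Unique.map⁺ proj₁-injective
  (Unique.map⁺ (toℕ-injective ∘ cong proj₁)
    (Unique.filter⁺ (λ i → T? (bit (toℕ i) y)) (Unique.allFin⁺ y)))
  where
  proj₁-injective : ∀ {p q : Σ ℕ (_< y)} → proj₁ p ≡ proj₁ q → p ≡ q
  proj₁-injective {a , a<y} {.a , a<y′} refl = cong (a ,_) (<-irrelevant a<y a<y′)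

unique-⊆⇒length-≤ : ∀ {xs ys : List ℕ} → Unique xs → (∀ {z} → z ∈ xs → z ∈ ys) → length xs ≤ length ys
unique-⊆⇒length-≤ {[]}     _          _  = z≤n
unique-⊆⇒length-≤ {x ∷ xs} {ys} (x∉xs ∷ xs-unique) xs⊆ys
  with us , vs , refl ← ∈-∃++ (xs⊆ys (here refl)) = begin
  suc (length xs)               ≤⟨ s≤s (unique-⊆⇒length-≤ xs-unique xs⊆us++vs) ⟩
  suc (length (us ++ vs))       ≡⟨ cong suc (length-++ us) ⟩
  suc (length us + length vs)   ≡⟨ +-suc (length us) (length vs) ⟨
  length us + length (x ∷ vs)   ≡⟨ length-++ us ⟨
  length (us ++ x ∷ vs)         ∎
  where
  open ≤-Reasoning
  xs⊆us++vs : ∀ {z} → z ∈ xs → z ∈ us ++ vs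
  xs⊆us++vs z∈xs with ∈-++⁻ us (xs⊆ys (there z∈xs))
  ... | inj₁ z∈us         = ∈-++⁺ˡ z∈us
  ... | inj₂ (here z≡x)   = ⊥-elim (All.lookup x∉xs z∈xs (sym z≡x))
  ... | inj₂ (there z∈vs) = ∈-++⁺ʳ us z∈vs

card-≤ : ∀ {y} {S : List ℕ} → (∀ {z} → z ∈ˢ y → z ∈ S) → card y ≤ length S
card-≤ {y} y⊆S = unique-⊆⇒length-≤ (elems-unique y) (y⊆S ∘ ∈-elems⁻)

∈-concatMap-find : ∀ {A : Set} (f : A → List ℕ) xs {z} → z ∈ concatMap f xs → ∃ λ x → x ∈ xs × z ∈ f x
∈-concatMap-find f xs = find ∘ ∈-concatMap⁻ f

∈-concatMap-intro : ∀ {A : Set} (f : A → List ℕ) {xs x z} → x ∈ xs → z ∈ f x → z ∈ concatMap f xs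
∈-concatMap-intro f x∈ z∈ = ∈-concatMap⁺ f (lose x∈ z∈)

w∷TC : ℕ → List ℕ
w∷TC w = w ∷ elems (TC w)

TC-unfold : ∀ x → TC x ≡ fromList (concatMap w∷TC (elems x))
TC-unfold x = trans (FixPoint.unfold-wfRec <-wellFounded (λ _ → ℕ) step step-ext {x})
                    (cong fromList (sym (concatMap-map w∷TC proj₁ (elemsLt x))))
  where
  step : (x : ℕ) → (∀ {z} → z < x → ℕ) → ℕ
  step x rec = fromList (concatMap (λ p → proj₁ p ∷ elems (rec (proj₂ p))) (elemsLt x))
  step-ext : ∀ x {IH IH′ : ∀ {z} → z < x → ℕ} → (∀ {z} (z<x : z < x) → IH z<x ≡ IH′ z<x) → step x IH ≡ step x IH′
  step-ext x IH≡IH′ = cong fromList (concatMap-cong (λ p → cong (λ t → proj₁ p ∷ elems t) (IH≡IH′ (proj₂ p))) (elemsLt x))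

∈-TC⁻ : ∀ {z x} → z ∈ˢ TC x → ∃ λ w → w ∈ˢ x × (z ≡ w ⊎ z ∈ˢ TC w)
∈-TC⁻ {z} {x} z∈TCx = witness (∈-concatMap-find w∷TC (elems x) (∈-fromList⁻ (concatMap w∷TC (elems x)) z∈))
  where
  z∈ : z ∈ˢ fromList (concatMap w∷TC (elems x))
  z∈ = subst (z ∈ˢ_) (TC-unfold x) z∈TCx
  witness : (∃ λ w → w ∈ elems x × z ∈ w∷TC w) → ∃ λ w → w ∈ˢ x × (z ≡ w ⊎ z ∈ˢ TC w)
  witness (w , w∈ , here z≡w)    = w , ∈-elems⁻ w∈ , inj₁ z≡w
  witness (w , w∈ , there z∈TCw) = w , ∈-elems⁻ w∈ , inj₂ (∈-elems⁻ z∈TCw)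

∈-TC⁺ : ∀ {z x w} → w ∈ˢ x → z ≡ w ⊎ z ∈ˢ TC w → z ∈ˢ TC x
∈-TC⁺ {z} {x} {w} w∈x z∈ = subst (z ∈ˢ_) (sym (TC-unfold x))
  (∈-fromList⁺ _ (∈-concatMap-intro w∷TC (∈-elems⁺ w∈x) ([ here , there ∘ ∈-elems⁺ ]′ z∈)))

x⊆TCx : ∀ {x} → x ⊆ˢ TC x
x⊆TCx w∈x = ∈-TC⁺ w∈x (inj₁ refl)

TC-transitive : ∀ x {w} → w ∈ˢ TC x → TC w ⊆ˢ TC x
TC-transitive = ∈-induction (λ x → ∀ {w} → w ∈ˢ TC x → TC w ⊆ˢ TC x) step
  where
  step : ∀ x → (∀ {v} → v ∈ˢ x → ∀ {w} → w ∈ˢ TC v → TC w ⊆ˢ TC v) → ∀ {w} → w ∈ˢ TC x → TC w ⊆ˢ TC x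
  step x IH {w} w∈TCx {z} z∈TCw = via (∈-TC⁻ w∈TCx)
    where
    via : (∃ λ v → v ∈ˢ x × (w ≡ v ⊎ w ∈ˢ TC v)) → z ∈ˢ TC x
    via (v , v∈x , inj₁ refl)  = ∈-TC⁺ v∈x (inj₂ z∈TCw)
    via (v , v∈x , inj₂ w∈TCv) = ∈-TC⁺ v∈x (inj₂ (IH v∈x w∈TCv z∈TCw))

TC-least : ∀ {x y} → x ⊆ˢ TC y → TC x ⊆ˢ TC y
TC-least {x} {y} x⊆TCy {z} z∈TCx = via (∈-TC⁻ z∈TCx)
  where
  via : (∃ λ w → w ∈ˢ x × (z ≡ w ⊎ z ∈ˢ TC w)) → z ∈ˢ TC y
  via (w , w∈x , inj₁ refl)  = x⊆TCy w∈x
  via (w , w∈x , inj₂ z∈TCw) = TC-transitive y (x⊆TCy w∈x) z∈TCw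

TC-mono : ∀ {x y} → x ⊆ˢ y → TC x ⊆ˢ TC y
TC-mono {x} {y} x⊆y = TC-least {x} {y} (λ w∈x → x⊆TCx (x⊆y w∈x))

cT-mono : ∀ {w x} → w ∈ˢ TC x → cT w ≤ cT x
cT-mono {x = x} w∈TCx = card-≤ (∈-elems⁺ ∘ TC-transitive x w∈TCx)

w∷TC-⊆ : ∀ {v x} → v ∈ˢ x → ∀ {u} → u ∈ w∷TC v → u ∈ w∷TC x
w∷TC-⊆         v∈x (here refl)     = there (∈-elems⁺ (x⊆TCx v∈x))
w∷TC-⊆ {x = x} v∈x (there u∈TCv) = there (∈-elems⁺ (TC-transitive x (x⊆TCx v∈x) (∈-elems⁻ u∈TCv)))

∈-bigUnion⁻ : ∀ {m} (as : Vec ℕ m) {z} → z ∈ˢ bigUnion as → ∃ λ a → a ∈ᵥ as × z ∈ˢ a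
∈-bigUnion⁻ as {z} z∈ = via (∈-concatMap-find elems (toList as) (∈-fromList⁻ (concatMap elems (toList as)) z∈))
  where
  via : (∃ λ a → a ∈ toList as × z ∈ elems a) → ∃ λ a → a ∈ᵥ as × z ∈ˢ a
  via (a , a∈ , z∈a) = a , ∈-toList⁻ a∈ , ∈-elems⁻ z∈a

∈-bigUnion⁺ : ∀ {m} {as : Vec ℕ m} {a} → a ∈ᵥ as → a ⊆ˢ bigUnion as
∈-bigUnion⁺ a∈as z∈a = ∈-fromList⁺ _ (∈-concatMap-intro elems (∈-toList⁺ a∈as) (∈-elems⁺ z∈a))

TC-bigUnion⁻ : ∀ {m} (as : Vec ℕ m) {z} → z ∈ˢ TC (bigUnion as) → ∃ λ a → a ∈ᵥ as × z ∈ˢ TC a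
TC-bigUnion⁻ as {z} z∈ = via (∈-TC⁻ z∈)
  where
  via : (∃ λ w → w ∈ˢ bigUnion as × (z ≡ w ⊎ z ∈ˢ TC w)) → ∃ λ a → a ∈ᵥ as × z ∈ˢ TC a
  via (w , w∈ , z≡w⊎z∈TCw) = Prod.map₂ (Prod.map₂ (λ w∈a → ∈-TC⁺ w∈a z≡w⊎z∈TCw)) (∈-bigUnion⁻ as w∈)

TC-bigUnion⁺ : ∀ {m} {as : Vec ℕ m} {a} → a ∈ᵥ as → TC a ⊆ˢ TC (bigUnion as)
TC-bigUnion⁺ {as = as} {a} a∈as = TC-mono {a} {bigUnion as} (∈-bigUnion⁺ a∈as)

∈-∷ʳ⁻ : ∀ {m} (as : Vec ℕ m) {a b} → a ∈ᵥ as ∷ʳ b → a ∈ᵥ as ⊎ a ≡ b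
∈-∷ʳ⁻ []       (here a≡b) = inj₂ a≡b
∈-∷ʳ⁻ (_ ∷ _)  (here a≡c) = inj₁ (here a≡c)
∈-∷ʳ⁻ (_ ∷ as) (there a∈) = map₁ there (∈-∷ʳ⁻ as a∈)

∈-last : ∀ {m} (as : Vec ℕ (suc m)) → last as ∈ᵥ as
∈-last (a ∷ [])     = here refl
∈-last (_ ∷ _ ∷ as) = there (∈-last (_ ∷ as))

image : (ℕ → ℕ) → ℕ → ℕ
image F x = fromList (L.map F (elems x))

∈-image⁻ : ∀ F x {v} → v ∈ˢ image F x → ∃ λ w → w ∈ˢ x × v ≡ F w
∈-image⁻ F x v∈ = Prod.map₂ (Prod.map₁ ∈-elems⁻) (∈-map⁻ F (∈-fromList⁻ (L.map F (elems x)) v∈))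

∈-rec-unfold : ∀ g x → ∈-rec g x ≡ g x (image (∈-rec g) x)
∈-rec-unfold g x = trans (FixPoint.unfold-wfRec <-wellFounded (λ _ → ℕ) step step-ext {x})
                         (cong (g x ∘ fromList) (map-∘ (elemsLt x)))
  where
  step : (x : ℕ) → (∀ {z} → z < x → ℕ) → ℕ
  step x rec = g x (fromList (L.map (λ p → rec (proj₂ p)) (elemsLt x)))
  step-ext : ∀ x {IH IH′ : ∀ {z} → z < x → ℕ} → (∀ {z} (z<x : z < x) → IH z<x ≡ IH′ z<x) → step x IH ≡ step x IH′
  step-ext x IH≡IH′ = cong (g x ∘ fromList) (map-cong (IH≡IH′ ∘ proj₂) (elemsLt x))

substP : ∀ {k n} → Poly k → (Fin k → Poly n) → Poly n
substP (var i)  qs = qs i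
substP (con c)  qs = con c
substP (p :+ q) qs = substP p qs :+ substP q qs
substP (p :* q) qs = substP p qs :* substP q qs

evalPoly-substP : ∀ {k n} (p : Poly k) (qs : Fin k → Poly n) v →
  evalPoly (substP p qs) v ≡ evalPoly p (tabulate (λ i → evalPoly (qs i) v))
evalPoly-substP (var i)  qs v = sym (lookup∘tabulate _ i)
evalPoly-substP (con c)  qs v = refl
evalPoly-substP (p :+ q) qs v = cong₂ _+_ (evalPoly-substP p qs v) (evalPoly-substP q qs v)
evalPoly-substP (p :* q) qs v = cong₂ _*_ (evalPoly-substP p qs v) (evalPoly-substP q qs v)

evalPoly-mono : ∀ {n} (p : Poly n) {u v : Vec ℕ n} → (∀ i → lookup u i ≤ lookup v i) → evalPoly p u ≤ evalPoly p v
evalPoly-mono (var i)  u≤v = u≤v i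
evalPoly-mono (con c)  u≤v = ≤-refl
evalPoly-mono (p :+ q) u≤v = +-mono-≤ (evalPoly-mono p u≤v) (evalPoly-mono q u≤v)
evalPoly-mono (p :* q) u≤v = *-mono-≤ (evalPoly-mono p u≤v) (evalPoly-mono q u≤v)

ΣP : ∀ {A : Set} {n} → (A → Poly n) → List A → Poly n
ΣP q []       = con 0
ΣP q (j ∷ js) = q j :+ ΣP q js

evalPoly-ΣP : ∀ {A : Set} {n} (q : A → Poly n) js v → evalPoly (ΣP q js) v ≡ sum (L.map (λ j → evalPoly (q j) v) js)
evalPoly-ΣP q []       v = refl
evalPoly-ΣP q (j ∷ js) v = cong (evalPoly (q j) v +_) (evalPoly-ΣP q js v)

length-concatMap-≤ : ∀ {A : Set} (f : A → List ℕ) (g : A → ℕ) xs →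
  (∀ {x} → x ∈ xs → length (f x) ≤ g x) → length (concatMap f xs) ≤ sum (L.map g xs)
length-concatMap-≤ f g []       _     = z≤n
length-concatMap-≤ f g (x ∷ xs) f≤g = begin
  length (f x ++ concatMap f xs)          ≡⟨ length-++ (f x) ⟩
  length (f x) + length (concatMap f xs)  ≤⟨ +-mono-≤ (f≤g (here refl)) (length-concatMap-≤ f g xs (f≤g ∘ there)) ⟩
  g x + sum (L.map g xs)                  ∎
  where open ≤-Reasoning

sum-map-≤ : ∀ {A : Set} (f : A → ℕ) {c} xs → (∀ {x} → x ∈ xs → f x ≤ c) → sum (L.map f xs) ≤ length xs * c
sum-map-≤ f []       _    = z≤n
sum-map-≤ f (x ∷ xs) f≤c = +-mono-≤ (f≤c (here refl)) (sum-map-≤ f xs (f≤c ∘ there))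

record Cover {m} (as : Vec ℕ m) (y bound : ℕ) : Set where
  constructor cover
  field
    extra   : List ℕ
    extra-≤ : length extra ≤ bound
    covers  : ∀ {z} → z ∈ˢ TC y → z ∈ˢ TC (bigUnion as) ⊎ z ∈ extra
open Cover

cover⇒cT-≤ : ∀ {m} {as : Vec ℕ m} {y c} → Cover as y c → cT y ≤ c + cT (bigUnion as)
cover⇒cT-≤ {as = as} {y} {c} C = begin
  cT y                                     ≤⟨ card-≤ {S = elems (TC U) ++ extra C} TCy⊆ ⟩
  length (elems (TC U) ++ extra C)         ≡⟨ length-++ (elems (TC U)) ⟩
  cT U + length (extra C)                  ≤⟨ +-monoʳ-≤ (cT U) (extra-≤ C) ⟩
  cT U + c                                 ≡⟨ +-comm (cT U) c ⟩
  c + cT U                                 ∎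
  where
  open ≤-Reasoning
  U : ℕ
  U = bigUnion as
  TCy⊆ : ∀ {z} → z ∈ˢ TC y → z ∈ elems (TC U) ++ extra C
  TCy⊆ z∈ = [ ∈-++⁺ˡ ∘ ∈-elems⁺ , ∈-++⁺ʳ (elems (TC U)) ]′ (covers C z∈)

cT-∅ : cT 0 ≡ 0
cT-∅ = cong card (TC-unfold 0)

cover-nullary⇒cT-≤ : ∀ {y c} → Cover [] y c → cT y ≤ c
cover-nullary⇒cT-≤ {y} {c} C = subst (cT y ≤_) (trans (cong (c +_) cT-∅) (+-identityʳ c)) (cover⇒cT-≤ C)

cover-self : ∀ {m} {as : Vec ℕ m} {y} → Cover as y (cT y)
cover-self = cover _ ≤-refl (inj₂ ∘ ∈-elems⁺)

cover-weaken : ∀ {m} {as : Vec ℕ m} {y c c′} → c ≤ c′ → Cover as y c → Cover as y c′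
cover-weaken c≤c′ (cover S S≤c TCy⊆) = cover S (≤-trans S≤c c≤c′) TCy⊆

cover-⊆ : ∀ {m} {as : Vec ℕ m} {a y} → a ∈ᵥ as → y ⊆ˢ TC a → Cover as y 0
cover-⊆ {as = as} {a} {y} a∈as y⊆TCa = cover [] z≤n (inj₁ ∘ TC-bigUnion⁺ a∈as ∘ TC-least {y} {a} y⊆TCa)

cover-comp : ∀ {m l} {as : Vec ℕ m} (ts : Fin l → ℕ) {cs : Fin l → ℕ} {y c} →
  (∀ j → Cover as (ts j) (cs j)) → Cover (tabulate ts) y c → Cover as y (c + sum (L.map cs (L.allFin l)))
cover-comp {m} {l} {as} ts {cs} {y} {c} Cts Cy = cover (extra Cy ++ Sts) length≤ TCy⊆
  where
  Sts : List ℕ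
  Sts = concatMap (extra ∘ Cts) (L.allFin l)
  length≤ : length (extra Cy ++ Sts) ≤ c + sum (L.map cs (L.allFin l))
  length≤ = begin
    length (extra Cy ++ Sts)         ≡⟨ length-++ (extra Cy) ⟩
    length (extra Cy) + length Sts   ≤⟨ +-mono-≤ (extra-≤ Cy) (length-concatMap-≤ (extra ∘ Cts) cs (L.allFin l) (λ {j} _ → extra-≤ (Cts j))) ⟩
    c + sum (L.map cs (L.allFin l))  ∎
    where open ≤-Reasoning
  via-argument : ∀ {z} → (∃ λ a → a ∈ᵥ tabulate ts × z ∈ˢ TC a) → z ∈ˢ TC (bigUnion as) ⊎ z ∈ extra Cy ++ Sts
  via-argument {z} (a , a∈ts , z∈TCa) = via-index (tabulate⁻ a∈ts) z∈TCa
    where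
    via-index : (∃ λ j → a ≡ ts j) → z ∈ˢ TC a → z ∈ˢ TC (bigUnion as) ⊎ z ∈ extra Cy ++ Sts
    via-index (j , refl) z∈TCtj =
      map₂ (∈-++⁺ʳ (extra Cy) ∘ ∈-concatMap-intro (extra ∘ Cts) (∈-allFin j)) (covers (Cts j) z∈TCtj)
  TCy⊆ : ∀ {z} → z ∈ˢ TC y → z ∈ˢ TC (bigUnion as) ⊎ z ∈ extra Cy ++ Sts
  TCy⊆ z∈TCy = [ via-argument ∘ TC-bigUnion⁻ (tabulate ts) , inj₂ ∘ ∈-++⁺ˡ ]′ (covers Cy z∈TCy)

cover-fromList : ∀ {m} {as : Vec ℕ m} (l : List ℕ) → (∀ {a} → a ∈ l → a ∈ᵥ as) → Cover as (fromList l) (length l)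
cover-fromList {as = as} l l⊆as = cover l ≤-refl TCl⊆
  where
  via : ∀ {z} → (∃ λ w → w ∈ˢ fromList l × (z ≡ w ⊎ z ∈ˢ TC w)) → z ∈ˢ TC (bigUnion as) ⊎ z ∈ l
  via (w , w∈ , inj₁ refl)  = inj₂ (∈-fromList⁻ l w∈)
  via (w , w∈ , inj₂ z∈TCw) = inj₁ (TC-bigUnion⁺ (l⊆as (∈-fromList⁻ l w∈)) z∈TCw)
  TCl⊆ : ∀ {z} → z ∈ˢ TC (fromList l) → z ∈ˢ TC (bigUnion as) ⊎ z ∈ l
  TCl⊆ = via ∘ ∈-TC⁻

TC-∅ : ∀ {z} → ¬ z ∈ˢ TC 0
TC-∅ z∈ = ∉∅ (proj₁ (proj₂ (∈-TC⁻ z∈)))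

⋃⊆TC : ∀ a → ⋃ₕ a ⊆ˢ TC a
⋃⊆TC a {z} z∈ = via (∈-concatMap-find elems (elems a) (∈-fromList⁻ (concatMap elems (elems a)) z∈))
  where
  via : (∃ λ v → v ∈ elems a × z ∈ elems v) → z ∈ˢ TC a
  via (v , v∈a , z∈v) = ∈-TC⁺ (∈-elems⁻ v∈a) (inj₂ (x⊆TCx (∈-elems⁻ z∈v)))

cover-cond : ∀ a b c d → Cover (a ∷ b ∷ c ∷ d ∷ []) (condₕ a b c d) 0
cover-cond a b c d with bit c d
... | true  = cover-⊆ (here refl) x⊆TCx
... | false = cover-⊆ (there (here refl)) x⊆TCx

sep⊆last : ∀ {m} (p : ℕ → Bool) (as : Vec ℕ (suc m)) → fromList (L.filterᵇ p (elems (last as))) ⊆ˢ last as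
sep⊆last p as z∈ = ∈-elems⁻ (proj₁ (∈-filter⁻ (T? ∘ p) {xs = elems (last as)} (∈-fromList⁻ _ z∈)))

Bounded⁻ : ∀ {m} → (Vec ℕ m → ℕ) → ℕ → Set
Bounded⁻ F c = ∀ as → Cover as (F as) c

bounded⁻ : ∀ {m} (h : PCSF⁻ m) → Σ ℕ (Bounded⁻ (eval⁻ h))
bounded⁻ (proj⁻ j)   = 0 , λ as → cover-⊆ (∈-lookup j as) x⊆TCx
bounded⁻ pair⁻       = 2 , λ { (a ∷ b ∷ []) → cover-fromList (a ∷ b ∷ []) pair⊆ }
  where
  pair⊆ : ∀ {a b x} → x ∈ a ∷ b ∷ [] → x ∈ᵥ a ∷ b ∷ []
  pair⊆ (here x≡a)         = here x≡a
  pair⊆ (there (here x≡b)) = there (here x≡b)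
bounded⁻ null⁻       = 0 , λ { [] → cover [] z≤n (⊥-elim ∘ TC-∅) }
bounded⁻ union⁻      = 0 , λ { (a ∷ []) → cover-⊆ (here refl) (⋃⊆TC a) }
bounded⁻ cond⁻       = 0 , λ { (a ∷ b ∷ c ∷ d ∷ []) → cover-cond a b c d }
bounded⁻ (comp⁻ h t) = proj₁ (bounded⁻ h) + sum (L.map (proj₁ ∘ bounded⁻ ∘ t) (L.allFin _)) ,
  λ as → cover-comp (λ j → eval⁻ (t j) as) (λ j → proj₂ (bounded⁻ (t j)) as) (proj₂ (bounded⁻ h) _)
bounded⁻ (sep⁻ h)    = 0 , λ as → cover-⊆ (∈-last as) (x⊆TCx ∘ sep⊆last _ as)

-- If every step g(u, S) is covered over (a⃗, S) with c(u) extra elements,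
-- then F = ∈-rec g is covered at x over a⃗ by the values F(u) together with
-- the step extras at u, for u ∈ {x} ∪ TC(x): an element of TC(F(x)) is
-- either an extra of the step at x, in TC(a⃗), or it lies in TC of the image
-- {F(v) : v ∈ x}, where it is some F(v) or is handled by induction at v.
cover-∈-rec : ∀ {m} (as : Vec ℕ m) (g : ℕ → ℕ → ℕ) (c : ℕ → ℕ) →
  (∀ u S → Cover (as ∷ʳ S) (g u S) (c u)) → ∀ x → Cover as (∈-rec g x) (sum (L.map (suc ∘ c) (w∷TC x)))
cover-∈-rec as g c step x =
  cover (extras x) (length-concatMap-≤ block (suc ∘ c) (w∷TC x) (λ {u} _ → s≤s (extra-≤ (C u)))) (covered x)
  where
  F : ℕ → ℕ
  F = ∈-rec g
  C : ∀ u → Cover (as ∷ʳ image F u) (g u (image F u)) (c u)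
  C u = step u (image F u)
  block : ℕ → List ℕ
  block u = F u ∷ extra (C u)
  extras : ℕ → List ℕ
  extras x = concatMap block (w∷TC x)

  extras-⊆ : ∀ {v x} → v ∈ˢ x → ∀ {z} → z ∈ extras v → z ∈ extras x
  extras-⊆ {v} v∈x z∈ =
    let u , u∈ , z∈block = ∈-concatMap-find block (w∷TC v) z∈ in ∈-concatMap-intro block (w∷TC-⊆ v∈x u∈) z∈block

  Covered : ℕ → Set
  Covered x = ∀ {z} → z ∈ˢ TC (F x) → z ∈ˢ TC (bigUnion as) ⊎ z ∈ extras x

  covered-step : ∀ x → (∀ {v} → v ∈ˢ x → Covered v) → Covered x
  covered-step x IH {z} z∈TCFx =
    [ from-argument ∘ TC-bigUnion⁻ (as ∷ʳ R) , inj₂ ∘ ∈-concatMap-intro block {xs = w∷TC x} (here refl) ∘ there ]′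
      (covers (C x) (subst (λ y → z ∈ˢ TC y) (∈-rec-unfold g x) z∈TCFx))
    where
    R : ℕ
    R = image F x
    from-value : ∀ {w} → (∃ λ v → v ∈ˢ x × w ≡ F v) → z ≡ w ⊎ z ∈ˢ TC w → z ∈ˢ TC (bigUnion as) ⊎ z ∈ extras x
    from-value (v , v∈x , refl) (inj₁ refl)    =
      inj₂ (∈-concatMap-intro block {xs = w∷TC x} (there (∈-elems⁺ (x⊆TCx v∈x))) (here refl))
    from-value (v , v∈x , refl) (inj₂ z∈TCFv) = map₂ (extras-⊆ v∈x) (IH v∈x z∈TCFv)
    from-image : (∃ λ w → w ∈ˢ R × (z ≡ w ⊎ z ∈ˢ TC w)) → z ∈ˢ TC (bigUnion as) ⊎ z ∈ extras x
    from-image (w , w∈R , z≡w⊎z∈TCw) = from-value (∈-image⁻ F x w∈R) z≡w⊎z∈TCw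
    from-position : ∀ {a} → a ∈ᵥ as ⊎ a ≡ R → z ∈ˢ TC a → z ∈ˢ TC (bigUnion as) ⊎ z ∈ extras x
    from-position (inj₁ a∈as) z∈TCa = inj₁ (TC-bigUnion⁺ a∈as z∈TCa)
    from-position (inj₂ refl) z∈TCR = from-image (∈-TC⁻ z∈TCR)
    from-argument : (∃ λ a → a ∈ᵥ as ∷ʳ R × z ∈ˢ TC a) → z ∈ˢ TC (bigUnion as) ⊎ z ∈ extras x
    from-argument (a , a∈ , z∈TCa) = from-position (∈-∷ʳ⁻ as a∈) z∈TCa

  covered : ∀ x → Covered x
  covered = ∈-induction Covered covered-step

Bounded : ∀ {n m} → (Vec ℕ n → Vec ℕ m → ℕ) → Poly n → Set
Bounded F p = ∀ xs as → Cover as (F xs as) (evalPoly p (map cT xs))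

-- A projection onto a normal argument xᵢ is covered by TC(xᵢ) itself,
-- a projection onto a safe argument needs no extras.
projPoly : ∀ {n m} → Fin n ⊎ Fin m → Poly n
projPoly (inj₁ i) = var i
projPoly (inj₂ i) = con 0

bounded-proj : ∀ {n m} (j : Fin (n + m)) → Bounded (λ xs as → lookup (xs ++ᵥ as) j) (projPoly {n} {m} (splitAt n j))
bounded-proj {n} {m} j xs as = cover-at (splitAt n j) (lookup-splitAt n xs as j)
  where
  cover-at : (s : Fin n ⊎ Fin m) → lookup (xs ++ᵥ as) j ≡ [ lookup xs , lookup as ]′ s →
             Cover as (lookup (xs ++ᵥ as) j) (evalPoly (projPoly s) (map cT xs))
  cover-at (inj₁ i) xs++as[j]≡xs[i] = subst (λ y → Cover as y _) (sym xs++as[j]≡xs[i])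
    (cover-weaken (≤-reflexive (sym (lookup-map i cT xs))) cover-self)
  cover-at (inj₂ i) xs++as[j]≡as[i] = subst (λ y → Cover as y 0) (sym xs++as[j]≡as[i])
    (cover-⊆ (∈-lookup i as) x⊆TCx)

-- Safe composition: the normal arguments rᵢ(x⃗/-) enter h through their
-- cT, bounded by prᵢ; the safe arguments tⱼ are handled by cover-comp.
bounded-scomp : ∀ {n m k l} {h : PCSF k l} {r : Fin k → PCSF n 0} {t : Fin l → PCSF n m} {ph pr pt} →
  Bounded (eval h) ph → (∀ i → Bounded (eval (r i)) (pr i)) → (∀ j → Bounded (eval (t j)) (pt j)) →
  Bounded (eval (scomp h r t)) (substP ph pr :+ ΣP pt (L.allFin l))
bounded-scomp {n} {k = k} {l} {h} {r} {t} {ph} {pr} {pt} Bh Br Bt xs as =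
  cover-weaken bound (cover-comp ts (λ j → Bt j xs as) (Bh (tabulate rs) (tabulate ts)))
  where
  v : Vec ℕ n
  v = map cT xs
  rs : Fin k → ℕ
  rs i = eval (r i) xs []
  ts : Fin l → ℕ
  ts j = eval (t j) xs as
  cT-rs≤ : ∀ i → lookup (map cT (tabulate rs)) i ≤ lookup (tabulate (λ i → evalPoly (pr i) v)) i
  cT-rs≤ i = begin
    lookup (map cT (tabulate rs)) i                 ≡⟨ lookup-map i cT (tabulate rs) ⟩
    cT (lookup (tabulate rs) i)                     ≡⟨ cong cT (lookup∘tabulate rs i) ⟩
    cT (rs i)                                       ≤⟨ cover-nullary⇒cT-≤ (Br i xs []) ⟩
    evalPoly (pr i) v                               ≡⟨ lookup∘tabulate (λ i → evalPoly (pr i) v) i ⟨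
    lookup (tabulate (λ i → evalPoly (pr i) v)) i   ∎
    where open ≤-Reasoning
  bound : evalPoly ph (map cT (tabulate rs)) + sum (L.map (λ j → evalPoly (pt j) v) (L.allFin l))
          ≤ evalPoly (substP ph pr) v + evalPoly (ΣP pt (L.allFin l)) v
  bound = +-mono-≤ (≤-trans (evalPoly-mono ph cT-rs≤) (≤-reflexive (sym (evalPoly-substP ph pr v))))
                   (≤-reflexive (sym (evalPoly-ΣP pt (L.allFin l) v)))

-- Predicative recursion: every u ∈ {x} ∪ TC(x) has cT(u) ≤ cT(x), so the
-- cT(x) + 1 steps of cover-∈-rec each contribute at most 1 + ph(cT(x), cT(y⃗)).
bounded-srec : ∀ {n m} {h : PCSF (suc n) (suc m)} {ph} →
  Bounded (eval h) ph → Bounded (eval (srec h)) ((var Fin.zero :+ con 1) :* (con 1 :+ ph))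
bounded-srec {h = h} {ph} Bh (x ∷ ys) as =
  cover-weaken bound (cover-∈-rec as g c (λ u S → Bh (u ∷ ys) (as ∷ʳ S)) x)
  where
  g : ℕ → ℕ → ℕ
  g u S = eval h (u ∷ ys) (as ∷ʳ S)
  c : ℕ → ℕ
  c u = evalPoly ph (cT u ∷ map cT ys)
  c-mono : ∀ {u} → u ∈ w∷TC x → c u ≤ c x
  c-mono u∈ = evalPoly-mono ph (cT-≤ u∈)
    where
    cT-≤ : ∀ {u} → u ∈ w∷TC x → ∀ i → lookup (cT u ∷ map cT ys) i ≤ lookup (cT x ∷ map cT ys) i
    cT-≤ (here refl)   Fin.zero    = ≤-refl
    cT-≤ (there u∈TCx) Fin.zero    = cT-mono {x = x} (∈-elems⁻ u∈TCx)
    cT-≤ _             (Fin.suc i) = ≤-refl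
  bound : sum (L.map (suc ∘ c) (w∷TC x)) ≤ (cT x + 1) * (1 + c x)
  bound = begin
    sum (L.map (suc ∘ c) (w∷TC x))  ≤⟨ sum-map-≤ (suc ∘ c) (w∷TC x) (s≤s ∘ c-mono) ⟩
    suc (cT x) * suc (c x)          ≡⟨ cong (_* suc (c x)) (+-comm 1 (cT x)) ⟩
    (cT x + 1) * (1 + c x)          ∎
    where open ≤-Reasoning

bounded : ∀ {n m} (f : PCSF n m) → Σ (Poly n) (Bounded (eval f))
bounded (base h)      = con (proj₁ (bounded⁻ h)) , λ { [] as → proj₂ (bounded⁻ h) as }
bounded {n} (proj j)  = projPoly (splitAt n j) , bounded-proj j
bounded (scomp {n} {k = k} {l} h r t) =
  substP ph pr :+ ΣP pt (L.allFin l) , bounded-scomp {h = h} {r} {t} {ph} {pr} {pt} Bh Br Bt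
  where
  ph : Poly k
  ph = proj₁ (bounded h)
  Bh : Bounded (eval h) ph
  Bh = proj₂ (bounded h)
  pr : Fin k → Poly n
  pr i = proj₁ (bounded (r i))
  Br : ∀ i → Bounded (eval (r i)) (pr i)
  Br i = proj₂ (bounded (r i))
  pt : Fin l → Poly n
  pt j = proj₁ (bounded (t j))
  Bt : ∀ j → Bounded (eval (t j)) (pt j)
  Bt j = proj₂ (bounded (t j))
bounded (srec {n} h) = (var Fin.zero :+ con 1) :* (con 1 :+ ph) , bounded-srec {h = h} {ph} (proj₂ (bounded h))
  where
  ph : Poly (suc n)
  ph = proj₁ (bounded h)

theorem5p1 : ∀ {n m} (f : PCSF n m) → Σ (Poly n) (λ p → ∀ (xs : Vec ℕ n) (as : Vec ℕ m) → cT (eval f xs as) ≤ evalPoly p (map cT xs) + cT (bigUnion as))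
theorem5p1 f = proj₁ (bounded f) , λ xs as → cover⇒cT-≤ (proj₂ (bounded f) xs as)
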